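{- Consider the Lie algebra of type $G_2$. Let $\ell\ge 1$ be an integer, $\lambda=\ell\varpi_2$, and $\mu=m_1\varpi_1+m_2\varpi_2$ with $m_1,m_2$ nonnegative integers satisfying $3\ell-1=2m_1+3m_2$. Write $m_1=3n+1$ (with $n$ a nonnegative integer). Then $m_q(\lambda,\mu)=q^{n+2}$.
   Context: Type $G_2$: simple roots $\alpha_1$ (short), $\alpha_2$ (long); positive roots $\alpha_1,\alpha_2,\alpha_1+\alpha_2,2\alpha_1+\alpha_2,3\alpha_1+\alpha_2,3\alpha_1+2\alpha_2$; $\varpi_1=2\alpha_1+\alpha_2$, $\varpi_2=3\alpha_1+2\alpha_2$, $\rho=\varpi_1+\varpi_2$. $W$ is the Weyl group generated by simple reflections $s_1,s_2$, and $\mathrm{len}(\sigma)$ is the length. For a weight $\xi$, $\wp_q(\xi)=\sum_{j\ge0}c_jq^j$, where $c_j$ is the number of ways to write $\xi$ as a nonnegative integral sum of exactly $j$ positive roots. The $q$-multiplicity is $m_q(\lambda,\mu)=\sum_{\sigma\in W}(-1)^{\mathrm{len}(\sigma)}\wp_q(\sigma(\lambda+\rho)-(\mu+\rho))$. -}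

module Defs where

open import Data.Nat using (ℕ; zero; suc)
open import Data.Integer using (ℤ; +_; _+_; _-_; _*_; -_)
import Data.Integer as ℤ
import Data.Nat as ℕ
open import Data.Product using (_×_; _,_)
open import Data.List using (List; []; _∷_; map; foldr; length)
open import Data.Bool using (Bool; true; false; if_then_else_; _∧_)
open import Relation.Nullary using (does)

-- Weights of G₂ in coordinates w.r.t. the simple roots:
-- (a , b) stands for a α₁ + b α₂.  (For G₂ the weight lattice equals
-- the root lattice, so integer coordinates suffice.)
Wt : Set
Wt = ℤ × ℤ

_⊕_ : Wt → Wt → Wt
(a , b) ⊕ (c , d) = (a + c , b + d)

_⊖_ : Wt → Wt → Wt
(a , b) ⊖ (c , d) = (a - c , b - d)

_·_ : ℤ → Wt → Wt
k · (a , b) = (k * a , k * b)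

-- simple roots: α₁ short, α₂ long
α₁ α₂ : Wt
α₁ = (+ 1 , + 0)
α₂ = (+ 0 , + 1)

positiveRoots : List Wt
positiveRoots =
  (+ 1 , + 0) ∷ (+ 0 , + 1) ∷ (+ 1 , + 1) ∷ (+ 2 , + 1) ∷ (+ 3 , + 1) ∷ (+ 3 , + 2) ∷ []

ϖ₁ ϖ₂ ρ : Wt
ϖ₁ = (+ 2 , + 1)
ϖ₂ = (+ 3 , + 2)
ρ = ϖ₁ ⊕ ϖ₂

-- simple reflections s_i(β) = β - ⟨β, α_i^∨⟩ α_i, with Cartan integers
-- ⟨α₂, α₁^∨⟩ = -3 and ⟨α₁, α₂^∨⟩ = -1:
-- ⟨aα₁+bα₂, α₁^∨⟩ = 2a - 3b,  ⟨aα₁+bα₂, α₂^∨⟩ = -a + 2b.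
s₁ : Wt → Wt
s₁ (a , b) = (a - (+ 2 * a - + 3 * b) , b)

s₂ : Wt → Wt
s₂ (a , b) = (a , b - (- a + + 2 * b))

data Gen : Set where
  g₁ g₂ : Gen

act : List Gen → Wt → Wt
act [] ξ = ξ
act (g₁ ∷ w) ξ = s₁ (act w ξ)
act (g₂ ∷ w) ξ = s₂ (act w ξ)

-- The 12 elements of the dihedral group W(G₂), each given by a reduced
-- word, so that len(σ) is the length of the word.
weylGroup : List (List Gen)
weylGroup =
  [] ∷
  (g₁ ∷ []) ∷ (g₂ ∷ []) ∷
  (g₁ ∷ g₂ ∷ []) ∷ (g₂ ∷ g₁ ∷ []) ∷
  (g₁ ∷ g₂ ∷ g₁ ∷ []) ∷ (g₂ ∷ g₁ ∷ g₂ ∷ []) ∷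
  (g₁ ∷ g₂ ∷ g₁ ∷ g₂ ∷ []) ∷ (g₂ ∷ g₁ ∷ g₂ ∷ g₁ ∷ []) ∷
  (g₁ ∷ g₂ ∷ g₁ ∷ g₂ ∷ g₁ ∷ []) ∷ (g₂ ∷ g₁ ∷ g₂ ∷ g₁ ∷ g₂ ∷ []) ∷
  (g₁ ∷ g₂ ∷ g₁ ∷ g₂ ∷ g₁ ∷ g₂ ∷ []) ∷ []

sign : ℕ → ℤ
sign zero = + 1
sign (suc zero) = - + 1
sign (suc (suc n)) = sign n

isZeroWt : Wt → Bool
isZeroWt (a , b) = does (a ℤ.≟ + 0) ∧ does (b ℤ.≟ + 0)

sumℕ : List ℕ → ℕ
sumℕ = foldr ℕ._+_ 0

upTo : ℕ → List ℕ
upTo zero = zero ∷ []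
upTo (suc n) = zero ∷ map suc (upTo n)

-- ways rs j ξ : number of tuples (k_β)_{β ∈ rs} of nonnegative integers
-- with Σ k_β = j and Σ k_β β = ξ  (each k_β ≤ j, so finite).
ways : List Wt → ℕ → Wt → ℕ
ways [] j ξ = if isZeroWt ξ ∧ does (j ℕ.≟ 0) then 1 else 0
ways (β ∷ rs) j ξ =
  sumℕ (map (λ k → ways rs (j ℕ.∸ k) (ξ ⊖ ((+ k) · β))) (upTo j))

-- coefficient of q^j in ℘_q(ξ): number of ways to write ξ as a
-- nonnegative integral sum of exactly j positive roots.
℘coeff : Wt → ℕ → ℕ
℘coeff ξ j = ways positiveRoots j ξ

-- q-polynomials with integer coefficients, as coefficient sequences
Poly : Set
Poly = ℕ → ℤ

qPow : ℕ → Poly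
qPow n j = if does (j ℕ.≟ n) then + 1 else + 0

sumℤ : List ℤ → ℤ
sumℤ = foldr _+_ (+ 0)

mq : Wt → Wt → Poly
mq λ' μ j =
  sumℤ (map (λ σ → sign (length σ) * + ℘coeff (act σ (λ' ⊕ ρ) ⊖ (μ ⊕ ρ)) j)
            weylGroup)

-- Only the identity and s₁ contribute to m_q(λ, μ): for every other σ the α₂-coordinate of
-- σ(λ + ρ) is at most ℓ + 2, smaller than that of μ + ρ, so the partition function vanishes.
-- The two surviving arguments are λ - μ = α₁ + (n+1)α₂ and s₁(λ + ρ) - (μ + ρ) = (n+1)α₂.
-- The second is written only as (n+1)·α₂, giving q^(n+1); the first either as
-- α₁ + (n+1)·α₂ or as (α₁ + α₂) + n·α₂, giving q^(n+2) + q^(n+1).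
module Submission where

open import Defs
open import Data.Bool using (true; false; if_then_else_)
open import Data.Bool.Properties using (∧-zeroʳ)
open import Data.Integer as ℤ using (ℤ; +_; -[1+_]; 0ℤ; 1ℤ; -_; _<_; _≤_; +<+)
import Data.Integer.Properties as ℤₚ
open import Data.Integer.Tactic.RingSolver using (solve-∀)
open import Data.List using (List; []; _∷_; map; drop; length)
open import Data.List.Properties using (map-∘; map-cong)
open import Data.List.Relation.Unary.All as All using (All; []; _∷_; all?)
open import Data.List.Relation.Unary.All.Properties using (drop⁺)
open import Data.Nat as ℕ using (ℕ; zero; suc; _+_; _*_; _∸_; _≥_)
import Data.Nat.Properties as ℕₚ
import Data.Nat.Tactic.RingSolver as ℕ-Ring
open import Data.Product using (_×_; _,_; proj₁; proj₂)
open import Data.Sum using (_⊎_; inj₁; inj₂)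
open import Relation.Binary.PropositionalEquality
open import Relation.Nullary using (does)
open import Relation.Nullary.Decidable using (dec-false; toWitness; _×-dec_)

i<j⇒i-j<0 : ∀ {i j} → i < j → i ℤ.- j < 0ℤ
i<j⇒i-j<0 {i} {j} i<j = subst (i ℤ.- j <_) (ℤₚ.+-inverseʳ j) (ℤₚ.+-monoˡ-< (- j) i<j)

⊖-zero· : ∀ ξ β → ξ ⊖ ((+ 0) · β) ≡ ξ
⊖-zero· (a , b) _ = cong₂ _,_ (ℤₚ.+-identityʳ a) (ℤₚ.+-identityʳ b)

⊖-suc· : ∀ ξ β k → ξ ⊖ ((+ suc k) · β) ≡ (ξ ⊖ β) ⊖ ((+ k) · β)
⊖-suc· (a , b) (c , d) k = cong₂ _,_ (shift a c (+ k)) (shift b d (+ k))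
  where
  shift : ∀ a c k → a ℤ.- (1ℤ ℤ.+ k) ℤ.* c ≡ (a ℤ.- c) ℤ.- k ℤ.* c
  shift = solve-∀

⊕-⊖-⊕ : ∀ u v w x → (u ⊕ v) ⊖ (w ⊕ x) ≡ (v ⊖ x) ⊕ (u ⊖ w)
⊕-⊖-⊕ (a , b) (c , d) (e , f) (g , h) = cong₂ _,_ (interchange a c e g) (interchange b d f h)
  where
  interchange : ∀ a c e g → (a ℤ.+ c) ℤ.- (e ℤ.+ g) ≡ (c ℤ.- g) ℤ.+ (a ℤ.- e)
  interchange = solve-∀

ways-nil-suc : ∀ j ξ → ways [] (suc j) ξ ≡ 0
ways-nil-suc j ξ rewrite ∧-zeroʳ (isZeroWt ξ) = refl

ways-cons-zero : ∀ β rs ξ → ways (β ∷ rs) 0 ξ ≡ ways rs 0 ξ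
ways-cons-zero β rs ξ = trans (ℕₚ.+-identityʳ _) (cong (ways rs 0) (⊖-zero· ξ β))

ways-cons-suc : ∀ β rs j ξ →
  ways (β ∷ rs) (suc j) ξ ≡ ways rs (suc j) ξ + ways (β ∷ rs) j (ξ ⊖ β)
ways-cons-suc β rs j ξ = cong₂ _+_ (cong (ways rs (suc j)) (⊖-zero· ξ β)) (begin
  sumℕ (map (λ k → ways rs (suc j ∸ k) (ξ ⊖ ((+ k) · β))) (map suc (upTo j)))
    ≡⟨ cong sumℕ (sym (map-∘ (upTo j))) ⟩
  sumℕ (map (λ k → ways rs (j ∸ k) (ξ ⊖ ((+ suc k) · β))) (upTo j))
    ≡⟨ cong sumℕ (map-cong (λ k → cong (ways rs (j ∸ k)) (⊖-suc· ξ β k)) (upTo j)) ⟩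
  sumℕ (map (λ k → ways rs (j ∸ k) ((ξ ⊖ β) ⊖ ((+ k) · β))) (upTo j)) ∎)
  where open ≡-Reasoning

NonNegativeWt : Wt → Set
NonNegativeWt (a , b) = ℤ.NonNegative a × ℤ.NonNegative b

HasNegativeCoordinate : Wt → Set
HasNegativeCoordinate (a , b) = a < 0ℤ ⊎ b < 0ℤ

⊖-hasNegativeCoordinate : ∀ ξ β → NonNegativeWt β →
  HasNegativeCoordinate ξ → HasNegativeCoordinate (ξ ⊖ β)
⊖-hasNegativeCoordinate (a , _) (c , _) (c≥0 , _) (inj₁ a<0) =
  inj₁ (ℤₚ.≤-<-trans (ℤₚ.i-j≤i a c ⦃ c≥0 ⦄) a<0)
⊖-hasNegativeCoordinate (_ , b) (_ , d) (_ , d≥0) (inj₂ b<0) =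
  inj₂ (ℤₚ.≤-<-trans (ℤₚ.i-j≤i b d ⦃ d≥0 ⦄) b<0)

ways-hasNegativeCoordinate : ∀ {rs} → All NonNegativeWt rs →
  ∀ j ξ → HasNegativeCoordinate ξ → ways rs j ξ ≡ 0
ways-hasNegativeCoordinate [] j (a , b) (inj₁ a<0)
  rewrite dec-false (a ℤ.≟ + 0) (ℤₚ.<⇒≢ a<0) = refl
ways-hasNegativeCoordinate [] j (a , b) (inj₂ b<0)
  rewrite dec-false (b ℤ.≟ + 0) (ℤₚ.<⇒≢ b<0) | ∧-zeroʳ (does (a ℤ.≟ + 0)) = refl
ways-hasNegativeCoordinate {β ∷ rs} (_ ∷ rs≥0) zero ξ neg =
  trans (ways-cons-zero β rs ξ) (ways-hasNegativeCoordinate rs≥0 0 ξ neg)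
ways-hasNegativeCoordinate {β ∷ rs} (β≥0 ∷ rs≥0) (suc j) ξ neg =
  trans (ways-cons-suc β rs j ξ)
        (cong₂ _+_ (ways-hasNegativeCoordinate rs≥0 (suc j) ξ neg)
                   (ways-hasNegativeCoordinate (β≥0 ∷ rs≥0) j (ξ ⊖ β)
                      (⊖-hasNegativeCoordinate ξ β β≥0 neg)))

ways-cons-irrelevant : ∀ {β rs} → All NonNegativeWt (β ∷ rs) →
  ∀ j ξ → proj₁ ξ < proj₁ β → ways (β ∷ rs) j ξ ≡ ways rs j ξ
ways-cons-irrelevant {β} {rs} _ zero ξ _ = ways-cons-zero β rs ξ
ways-cons-irrelevant {β} {rs} nonNeg (suc j) ξ ξ₁<β₁ = begin
  ways (β ∷ rs) (suc j) ξ                      ≡⟨ ways-cons-suc β rs j ξ ⟩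
  ways rs (suc j) ξ + ways (β ∷ rs) j (ξ ⊖ β)  ≡⟨ cong (_+_ (ways rs (suc j) ξ)) ξ-β-vanishes ⟩
  ways rs (suc j) ξ + 0                        ≡⟨ ℕₚ.+-identityʳ _ ⟩
  ways rs (suc j) ξ                            ∎
  where
  open ≡-Reasoning
  ξ-β-vanishes : ways (β ∷ rs) j (ξ ⊖ β) ≡ 0
  ξ-β-vanishes = ways-hasNegativeCoordinate nonNeg j (ξ ⊖ β) (inj₁ (i<j⇒i-j<0 ξ₁<β₁))

positiveRoots-nonNegative : ∀ k → All NonNegativeWt (drop k positiveRoots)
positiveRoots-nonNegative k = drop⁺ k (_ ∷ _ ∷ _ ∷ _ ∷ _ ∷ _ ∷ [])

qPowℕ : ℕ → ℕ → ℕ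
qPowℕ k j = if does (j ℕ.≟ k) then 1 else 0

+qPowℕ : ∀ k j → + qPowℕ k j ≡ qPow k j
+qPowℕ k j with does (j ℕ.≟ k)
... | true  = refl
... | false = refl

ways-drop₃-α₁<2 : ∀ j {a} y → a < + 2 →
  ways (drop 3 positiveRoots) j (a , y) ≡ ways [] j (a , y)
ways-drop₃-α₁<2 j {a} y a<2 = begin
  ways (drop 3 positiveRoots) j (a , y)  ≡⟨ ways-cons-irrelevant (positiveRoots-nonNegative 3) j (a , y) a<2 ⟩
  ways (drop 4 positiveRoots) j (a , y)  ≡⟨ ways-cons-irrelevant (positiveRoots-nonNegative 4) j (a , y) a<3 ⟩
  ways (drop 5 positiveRoots) j (a , y)  ≡⟨ ways-cons-irrelevant (positiveRoots-nonNegative 5) j (a , y) a<3 ⟩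
  ways [] j (a , y)                      ∎
  where
  open ≡-Reasoning
  a<3 = ℤₚ.<-trans a<2 (+<+ (ℕₚ.n<1+n 2))

ways-drop₂-α₁≡0 : ∀ j y → ways (drop 2 positiveRoots) j (0ℤ , y) ≡ ways [] j (0ℤ , y)
ways-drop₂-α₁≡0 j y =
  trans (ways-cons-irrelevant (positiveRoots-nonNegative 2) j (0ℤ , y) (+<+ (ℕ.s≤s ℕ.z≤n)))
        (ways-drop₃-α₁<2 j y (+<+ (ℕ.s≤s ℕ.z≤n)))

ways-drop₂-α₁≡1-zero : ∀ y → ways (drop 2 positiveRoots) 0 (1ℤ , y) ≡ 0
ways-drop₂-α₁≡1-zero y =
  trans (ways-cons-zero (α₁ ⊕ α₂) (drop 3 positiveRoots) (1ℤ , y))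
        (ways-drop₃-α₁<2 0 y (+<+ (ℕ.s≤s (ℕ.s≤s ℕ.z≤n))))

ways-drop₂-α₁≡1-suc : ∀ j y →
  ways (drop 2 positiveRoots) (suc j) (1ℤ , y) ≡ ways [] j (0ℤ , y ℤ.- 1ℤ)
ways-drop₂-α₁≡1-suc j y = begin
  ways (drop 2 positiveRoots) (suc j) (1ℤ , y)
    ≡⟨ ways-cons-suc (α₁ ⊕ α₂) (drop 3 positiveRoots) j (1ℤ , y) ⟩
  ways (drop 3 positiveRoots) (suc j) (1ℤ , y) + ways (drop 2 positiveRoots) j (0ℤ , y ℤ.- 1ℤ)
    ≡⟨ cong₂ _+_ (trans (ways-drop₃-α₁<2 (suc j) y (+<+ (ℕ.s≤s (ℕ.s≤s ℕ.z≤n)))) (ways-nil-suc j (1ℤ , y)))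
                 (ways-drop₂-α₁≡0 j (y ℤ.- 1ℤ)) ⟩
  ways [] j (0ℤ , y ℤ.- 1ℤ) ∎
  where open ≡-Reasoning

ways-drop₁-bα₂ : ∀ j b → ways (drop 1 positiveRoots) j (0ℤ , + b) ≡ qPowℕ b j
ways-drop₁-bα₂ zero b =
  trans (ways-cons-zero α₂ (drop 2 positiveRoots) (0ℤ , + b))
        (trans (ways-drop₂-α₁≡0 0 (+ b)) (at-zero b))
  where
  at-zero : ∀ b → ways [] 0 (0ℤ , + b) ≡ qPowℕ b 0
  at-zero zero    = refl
  at-zero (suc b) = refl
ways-drop₁-bα₂ (suc j) b =
  trans (ways-cons-suc α₂ (drop 2 positiveRoots) j (0ℤ , + b))
        (cong₂ _+_ (trans (ways-drop₂-α₁≡0 (suc j) (+ b)) (ways-nil-suc j (0ℤ , + b)))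
                   (without-α₂ b))
  where
  without-α₂ : ∀ b → ways (drop 1 positiveRoots) j (0ℤ , + b ℤ.- 1ℤ) ≡ qPowℕ b (suc j)
  without-α₂ zero    = ways-hasNegativeCoordinate (positiveRoots-nonNegative 1) j (0ℤ , -[1+ 0 ]) (inj₂ ℤ.-<+)
  without-α₂ (suc b) = ways-drop₁-bα₂ j b

ways-drop₁-α₁ : ∀ j → ways (drop 1 positiveRoots) j (1ℤ , 0ℤ) ≡ 0
ways-drop₁-α₁ zero =
  trans (ways-cons-zero α₂ (drop 2 positiveRoots) (1ℤ , 0ℤ)) (ways-drop₂-α₁≡1-zero 0ℤ)
ways-drop₁-α₁ (suc j) =
  trans (ways-cons-suc α₂ (drop 2 positiveRoots) j (1ℤ , 0ℤ))
        (cong₂ _+_ (trans (ways-drop₂-α₁≡1-suc j 0ℤ)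
                          (ways-hasNegativeCoordinate [] j (0ℤ , -[1+ 0 ]) (inj₂ ℤ.-<+)))
                   (ways-hasNegativeCoordinate (positiveRoots-nonNegative 1) j (1ℤ , -[1+ 0 ]) (inj₂ ℤ.-<+)))

ways-drop₁-α₁+[1+b]α₂ : ∀ j b → ways (drop 1 positiveRoots) j (1ℤ , + suc b) ≡ qPowℕ (suc b) j
ways-drop₁-α₁+[1+b]α₂ zero b =
  trans (ways-cons-zero α₂ (drop 2 positiveRoots) (1ℤ , + suc b)) (ways-drop₂-α₁≡1-zero (+ suc b))
ways-drop₁-α₁+[1+b]α₂ (suc j) b =
  trans (ways-cons-suc α₂ (drop 2 positiveRoots) j (1ℤ , + suc b))
        (trans (cong (_+ ways (drop 1 positiveRoots) j (1ℤ , + b)) (ways-drop₂-α₁≡1-suc j (+ suc b)))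
               (without-α₂ b))
  where
  without-α₂ : ∀ b → ways [] j (0ℤ , + b) + ways (drop 1 positiveRoots) j (1ℤ , + b) ≡ qPowℕ b j
  without-α₂ zero    = trans (cong (_+_ (qPowℕ 0 j)) (ways-drop₁-α₁ j)) (ℕₚ.+-identityʳ _)
  without-α₂ (suc b) = ways-drop₁-α₁+[1+b]α₂ j b

℘coeff-bα₂ : ∀ b j → ℘coeff (0ℤ , + b) j ≡ qPowℕ b j
℘coeff-bα₂ b j =
  trans (ways-cons-irrelevant (positiveRoots-nonNegative 0) j (0ℤ , + b) (+<+ (ℕ.s≤s ℕ.z≤n)))
        (ways-drop₁-bα₂ j b)

℘coeff-α₁+[1+b]α₂ : ∀ b j → ℘coeff (1ℤ , + suc b) j ≡ qPowℕ (suc b) j + qPowℕ (suc (suc b)) j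
℘coeff-α₁+[1+b]α₂ b zero =
  trans (ways-cons-zero α₁ (drop 1 positiveRoots) (1ℤ , + suc b)) (ways-drop₁-α₁+[1+b]α₂ 0 b)
℘coeff-α₁+[1+b]α₂ b (suc j) = begin
  ℘coeff (1ℤ , + suc b) (suc j)
    ≡⟨ ways-cons-suc α₁ (drop 1 positiveRoots) j (1ℤ , + suc b) ⟩
  ways (drop 1 positiveRoots) (suc j) (1ℤ , + suc b) + ℘coeff (0ℤ , + suc b ℤ.+ 0ℤ) j
    ≡⟨ cong₂ _+_ (ways-drop₁-α₁+[1+b]α₂ (suc j) b)
                 (trans (cong (λ y → ℘coeff (0ℤ , y) j) (ℤₚ.+-identityʳ (+ suc b))) (℘coeff-bα₂ (suc b) j)) ⟩
  qPowℕ (suc b) (suc j) + qPowℕ (suc b) j ∎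
  where open ≡-Reasoning

℘-difference : ∀ n j →
  + ℘coeff (1ℤ , + suc n) j ℤ.- + ℘coeff (0ℤ , + suc n) j ≡ qPow (suc (suc n)) j
℘-difference n j rewrite ℘coeff-α₁+[1+b]α₂ n j | ℘coeff-bα₂ (suc n) j =
  trans (cancel (+ qPowℕ (suc n) j) (+ qPowℕ (suc (suc n)) j)) (+qPowℕ (suc (suc n)) j)
  where
  cancel : ∀ x y → (x ℤ.+ y) ℤ.- x ≡ y
  cancel = solve-∀

s₁-linear : ∀ k u v → s₁ ((k · u) ⊕ v) ≡ (k · s₁ u) ⊕ s₁ v
s₁-linear k (a , b) (c , d) = cong (_, k ℤ.* b ℤ.+ d) (linear k a b c d)
  where
  linear : ∀ k a b c d →
    (k ℤ.* a ℤ.+ c) ℤ.- (+ 2 ℤ.* (k ℤ.* a ℤ.+ c) ℤ.- + 3 ℤ.* (k ℤ.* b ℤ.+ d))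
      ≡ k ℤ.* (a ℤ.- (+ 2 ℤ.* a ℤ.- + 3 ℤ.* b)) ℤ.+ (c ℤ.- (+ 2 ℤ.* c ℤ.- + 3 ℤ.* d))
  linear = solve-∀

s₂-linear : ∀ k u v → s₂ ((k · u) ⊕ v) ≡ (k · s₂ u) ⊕ s₂ v
s₂-linear k (a , b) (c , d) = cong (k ℤ.* a ℤ.+ c ,_) (linear k a b c d)
  where
  linear : ∀ k a b c d →
    (k ℤ.* b ℤ.+ d) ℤ.- (- (k ℤ.* a ℤ.+ c) ℤ.+ + 2 ℤ.* (k ℤ.* b ℤ.+ d))
      ≡ k ℤ.* (b ℤ.- (- a ℤ.+ + 2 ℤ.* b)) ℤ.+ (d ℤ.- (- c ℤ.+ + 2 ℤ.* d))
  linear = solve-∀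

act-linear : ∀ σ k u v → act σ ((k · u) ⊕ v) ≡ (k · act σ u) ⊕ act σ v
act-linear []       k u v = refl
act-linear (g₁ ∷ σ) k u v = trans (cong s₁ (act-linear σ k u v)) (s₁-linear k (act σ u) (act σ v))
act-linear (g₂ ∷ σ) k u v = trans (cong s₂ (act-linear σ k u v)) (s₂-linear k (act σ u) (act σ v))

s₁-ℓϖ₂+ρ : ∀ ℓ → s₁ (((+ ℓ) · ϖ₂) ⊕ ρ) ≡ ((+ ℓ) · ϖ₂) ⊕ s₁ ρ
s₁-ℓϖ₂+ρ ℓ = act-linear (g₁ ∷ []) (+ ℓ) ϖ₂ ρ

SmallOnϖ₂Andρ : List Gen → Set
SmallOnϖ₂Andρ σ = proj₂ (act σ ϖ₂) ≤ 1ℤ × proj₂ (act σ ρ) ≤ + 2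

-- σϖ₂ is a long root and σϖ₁ a short one; both have α₂-coordinate at most 1
-- unless σϖ₂ = ϖ₂, i.e. σ ∈ {1, s₁}.
smallOnϖ₂Andρ : All SmallOnϖ₂Andρ (drop 2 weylGroup)
smallOnϖ₂Andρ =
  toWitness {a? = all? (λ σ → proj₂ (act σ ϖ₂) ℤ.≤? 1ℤ ×-dec proj₂ (act σ ρ) ℤ.≤? + 2) (drop 2 weylGroup)} _

α₂-coordinate-σ[ℓϖ₂+ρ] : ∀ σ ℓ → SmallOnϖ₂Andρ σ → proj₂ (act σ (((+ ℓ) · ϖ₂) ⊕ ρ)) ≤ + (ℓ + 2)
α₂-coordinate-σ[ℓϖ₂+ρ] σ ℓ (ϖ₂-small , ρ-small) rewrite act-linear σ (+ ℓ) ϖ₂ ρ =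
  ℤₚ.+-mono-≤ (ℤₚ.≤-trans (ℤₚ.*-monoˡ-≤-nonNeg (+ ℓ) ϖ₂-small) (ℤₚ.≤-reflexive (ℤₚ.*-identityʳ (+ ℓ))))
              ρ-small

α₂-coordinate-μ+ρ : ∀ m₁ m₂ → proj₂ ((((+ m₁) · ϖ₁) ⊕ ((+ m₂) · ϖ₂)) ⊕ ρ) ≡ + (m₁ + 2 * m₂ + 3)
α₂-coordinate-μ+ρ m₁ m₂ =
  trans (cong₂ (λ x y → x ℤ.+ y ℤ.+ + 3) (sym (ℤₚ.pos-* m₁ 1)) (sym (ℤₚ.pos-* m₂ 2)))
        (cong (λ x → + (x + 3)) (cong₂ _+_ (ℕₚ.*-identityʳ m₁) (ℕₚ.*-comm m₂ 2)))

sumℤ-zeros : ∀ {A : Set} (f : A → ℤ) {xs} → All (λ x → f x ≡ 0ℤ) xs → sumℤ (map f xs) ≡ 0ℤ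
sumℤ-zeros f []       = refl
sumℤ-zeros f (p ∷ ps) = cong₂ ℤ._+_ p (sumℤ-zeros f ps)

mq-ℓϖ₂ : ∀ ℓ m₁ m₂ j → ℓ ℕ.≤ m₁ + 2 * m₂ →
  let λ+ρ = ((+ ℓ) · ϖ₂) ⊕ ρ
      μ+ρ = (((+ m₁) · ϖ₁) ⊕ ((+ m₂) · ϖ₂)) ⊕ ρ
  in mq ((+ ℓ) · ϖ₂) (((+ m₁) · ϖ₁) ⊕ ((+ m₂) · ϖ₂)) j
       ≡ + ℘coeff (λ+ρ ⊖ μ+ρ) j ℤ.- + ℘coeff (s₁ λ+ρ ⊖ μ+ρ) j
mq-ℓϖ₂ ℓ m₁ m₂ j ℓ≤ =
  trans (cong (λ rest → term [] ℤ.+ (term (g₁ ∷ []) ℤ.+ rest))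
              (sumℤ-zeros term (All.map (λ {σ} → term-vanishes σ) smallOnϖ₂Andρ)))
        (signed-difference (+ ℘coeff (λ+ρ ⊖ μ+ρ) j) (+ ℘coeff (s₁ λ+ρ ⊖ μ+ρ) j))
  where
  λ+ρ μ+ρ : Wt
  λ+ρ = ((+ ℓ) · ϖ₂) ⊕ ρ
  μ+ρ = (((+ m₁) · ϖ₁) ⊕ ((+ m₂) · ϖ₂)) ⊕ ρ

  term : List Gen → ℤ
  term σ = sign (length σ) ℤ.* + ℘coeff (act σ λ+ρ ⊖ μ+ρ) j

  ℓ+2<α₂-coordinate-μ+ρ : + (ℓ + 2) < proj₂ μ+ρ
  ℓ+2<α₂-coordinate-μ+ρ rewrite α₂-coordinate-μ+ρ m₁ m₂ = +<+ (ℕₚ.+-mono-≤-< ℓ≤ (ℕₚ.n<1+n 2))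

  term-vanishes : ∀ σ → SmallOnϖ₂Andρ σ → term σ ≡ 0ℤ
  term-vanishes σ small =
    trans (cong (λ c → sign (length σ) ℤ.* + c)
                (ways-hasNegativeCoordinate (positiveRoots-nonNegative 0) j (act σ λ+ρ ⊖ μ+ρ)
                   (inj₂ (i<j⇒i-j<0 (ℤₚ.≤-<-trans (α₂-coordinate-σ[ℓϖ₂+ρ] σ ℓ small) ℓ+2<α₂-coordinate-μ+ρ)))))
          (ℤₚ.*-zeroʳ (sign (length σ)))

  signed-difference : ∀ a b → + 1 ℤ.* a ℤ.+ (- + 1 ℤ.* b ℤ.+ 0ℤ) ≡ a ℤ.- b
  signed-difference = solve-∀

λ-μ : ∀ ℓ n m → ℓ ≡ 2 * n + 1 + m →
  ((+ ℓ) · ϖ₂) ⊖ (((+ (3 * n + 1)) · ϖ₁) ⊕ ((+ m) · ϖ₂)) ≡ (1ℤ , + suc n)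
λ-μ _ n m refl =
  trans (cong₂ (λ L M₁ → (L · ϖ₂) ⊖ ((M₁ · ϖ₁) ⊕ ((+ m) · ϖ₂)))
               (cong (λ x → x ℤ.+ 1ℤ ℤ.+ + m) (ℤₚ.pos-* 2 n))
               (cong (ℤ._+ 1ℤ) (ℤₚ.pos-* 3 n)))
        (cong₂ _,_ (α₁-coordinate (+ n) (+ m)) (α₂-coordinate (+ n) (+ m)))
  where
  α₁-coordinate : ∀ N M →
    (+ 2 ℤ.* N ℤ.+ 1ℤ ℤ.+ M) ℤ.* + 3 ℤ.- ((+ 3 ℤ.* N ℤ.+ 1ℤ) ℤ.* + 2 ℤ.+ M ℤ.* + 3) ≡ 1ℤ
  α₁-coordinate = solve-∀
  α₂-coordinate : ∀ N M →
    (+ 2 ℤ.* N ℤ.+ 1ℤ ℤ.+ M) ℤ.* + 2 ℤ.- ((+ 3 ℤ.* N ℤ.+ 1ℤ) ℤ.* + 1 ℤ.+ M ℤ.* + 2) ≡ 1ℤ ℤ.+ N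
  α₂-coordinate = solve-∀

λ+ν-μ+ρ : ∀ ℓ n m ν → ℓ ≡ 2 * n + 1 + m →
  (((+ ℓ) · ϖ₂) ⊕ ν) ⊖ ((((+ (3 * n + 1)) · ϖ₁) ⊕ ((+ m) · ϖ₂)) ⊕ ρ) ≡ (ν ⊖ ρ) ⊕ (1ℤ , + suc n)
λ+ν-μ+ρ ℓ n m ν ℓ≡ = trans (⊕-⊖-⊕ ((+ ℓ) · ϖ₂) ν _ ρ) (cong ((ν ⊖ ρ) ⊕_) (λ-μ ℓ n m ℓ≡))

ℓ≡2n+1+m : ∀ ℓ n m → 3 * ℓ ≡ 2 * (3 * n + 1) + 3 * m + 1 → ℓ ≡ 2 * n + 1 + m
ℓ≡2n+1+m ℓ n m h = ℕₚ.*-cancelˡ-≡ ℓ (2 * n + 1 + m) 3 (trans h (arith n m))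
  where
  arith : ∀ n m → 2 * (3 * n + 1) + 3 * m + 1 ≡ 3 * (2 * n + 1 + m)
  arith = ℕ-Ring.solve-∀

2n+1+m≤3n+1+2m : ∀ n m → 2 * n + 1 + m ℕ.≤ 3 * n + 1 + 2 * m
2n+1+m≤3n+1+2m n m = ℕₚ.+-mono-≤ (ℕₚ.+-monoˡ-≤ 1 (ℕₚ.*-monoˡ-≤ n (ℕₚ.n≤1+n 2))) (ℕₚ.m≤n*m m 2)

theorem1p6 : (ℓ m₁ m₂ n : ℕ) → ℓ ≥ 1 → 3 * ℓ ≡ 2 * m₁ + 3 * m₂ + 1 → m₁ ≡ 3 * n + 1 →
    (j : ℕ) → mq ((+ ℓ) · ϖ₂) (((+ m₁) · ϖ₁) ⊕ ((+ m₂) · ϖ₂)) j ≡ qPow (n + 2) j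
-- ℓ ≥ 1 is implied by the other two hypotheses.
theorem1p6 ℓ m₁ m₂ n _ h refl j = begin
  mq λ' μ j
    ≡⟨ mq-ℓϖ₂ ℓ m₁ m₂ j (subst (ℕ._≤ m₁ + 2 * m₂) (sym ℓ≡) (2n+1+m≤3n+1+2m n m₂)) ⟩
  + ℘coeff ((λ' ⊕ ρ) ⊖ (μ ⊕ ρ)) j ℤ.- + ℘coeff (s₁ (λ' ⊕ ρ) ⊖ (μ ⊕ ρ)) j
    ≡⟨ cong₂ (λ ξ η → + ℘coeff ξ j ℤ.- + ℘coeff η j)
             (λ+ν-μ+ρ ℓ n m₂ ρ ℓ≡)
             (trans (cong (_⊖ (μ ⊕ ρ)) (s₁-ℓϖ₂+ρ ℓ)) (λ+ν-μ+ρ ℓ n m₂ (s₁ ρ) ℓ≡)) ⟩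
  + ℘coeff (1ℤ , + suc n) j ℤ.- + ℘coeff (0ℤ , + suc n) j
    ≡⟨ ℘-difference n j ⟩
  qPow (2 + n) j
    ≡⟨ cong (λ k → qPow k j) (ℕₚ.+-comm 2 n) ⟩
  qPow (n + 2) j ∎
  where
  open ≡-Reasoning
  λ' μ : Wt
  λ' = (+ ℓ) · ϖ₂
  μ  = ((+ m₁) · ϖ₁) ⊕ ((+ m₂) · ϖ₂)
  ℓ≡ : ℓ ≡ 2 * n + 1 + m₂
  ℓ≡ = ℓ≡2n+1+m ℓ n m₂ h
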